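{- Let $k$ and $t$ be positive integers, and let $I_k=\{i\in\mathbb{Z}:-k\le i\le k\}$. Consider the zero-sum sequences $U=k\cdot(-1)^{[k]}$ and $V=(k-1)\cdot(-1)^{[k-1]}$ over $I_k$. (a) If $k+1$ divides $t$, then $S=U^{[\frac{t}{k+1}-1]}\cdot V^{[k]}$ is a zero-sum sequence over $I_k$ that contains no zero-sum subsequence of length $t$. (b) If $k$ divides $t$, then $R=U^{[k-1]}\cdot V^{[\frac{t}{k}-1]}$ is a zero-sum sequence over $I_k$ that contains no zero-sum subsequence of length $t$. Consequently, if $k+1$ divides $t$ or $k$ divides $t$, then $\mathsf{s}'_t(I_k)\ge t+k(k-1)$.
   Context: A sequence over $G_0\subseteq\mathbb{Z}$ is a finite unordered list of elements of $G_0$ with repetition allowed; $|S|$ is its length and $\sigma(S)$ its sum; a subsequence is a sub-multiset; $S$ is zero-sum if $\sigma(S)=0$. Products $A\cdot B$ denote concatenation of sequences, $a\cdot b$ for integers $a,b$ denotes the sequence with terms $a,b$, and $A^{[d]}$ denotes the concatenation of $d$ copies of $A$ ($A^{[0]}$ is empty). For a positive integer $t$, $\mathsf{s}'_t(I_k)$ is the smallest positive integer $\ell$ such that every zero-sum sequence over $I_k$ of length at least $\ell$ contains a zero-sum subsequence of length $t$ ($\infty$ if none exists). -}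

module Defs where

open import Data.Nat using (ℕ; _∸_; _+_; _*_; _≤_)
open import Data.Integer as ℤ using (ℤ; +_; -[1+_])
open import Data.List using (List; []; _∷_; replicate; concat; length; foldr)
open import Data.List.Relation.Unary.All using (All)
open import Data.List.Relation.Binary.Sublist.Propositional using (_⊆_)
open import Data.Product using (_×_; ∃-syntax)
open import Relation.Binary.PropositionalEquality using (_≡_)

-- A sequence over a subset of ℤ is a finite list (order irrelevant).
Seq : Set
Seq = List ℤ

σ : Seq → ℤ
σ = foldr ℤ._+_ (+ 0)

ZeroSum : Seq → Set
ZeroSum S = σ S ≡ + 0

InI : ℕ → ℤ → Set
InI k x = (ℤ.- (+ k)) ℤ.≤ x × x ℤ.≤ + k

OverI : ℕ → Seq → Set
OverI k S = All (InI k) S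

-- A subsequence (sub-multiset) of S: a sublist of S (every sub-multiset
-- of S arises as a sublist, and conversely).
Subseq : Seq → Seq → Set
Subseq T S = T ⊆ S

HasZeroSumSubseqOfLength : ℕ → Seq → Set
HasZeroSumSubseqOfLength t S = ∃[ T ] (Subseq T S × ZeroSum T × length T ≡ t)

_^[_] : Seq → ℕ → Seq
A ^[ d ] = concat (replicate d A)

-1ℤ : ℤ
-1ℤ = -[1+ 0 ]

U : ℕ → Seq
U k = + k ∷ replicate k -1ℤ

V : ℕ → Seq
V k = + (k ∸ 1) ∷ replicate (k ∸ 1) -1ℤ

s'Property : ℕ → ℕ → ℕ → Set
s'Property k t ℓ = (S : Seq) → OverI k S → ZeroSum S → ℓ ≤ length S →
                   HasZeroSumSubseqOfLength t S

-- s'_t(I_k) ≥ L : every positive ℓ with the property is ≥ L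
-- (this is what "the least such ℓ, or ∞ if none, is ≥ L" unfolds to).
s'≥ : ℕ → ℕ → ℕ → Set
s'≥ k t L = (ℓ : ℕ) → 1 ≤ ℓ → s'Property k t ℓ → L ≤ ℓ

-- Give every term x the weight x + 1, so that a sequence T has weight σ(T) + |T|
-- and a zero-sum T has weight |T|. In a block c·(-1)^[m] the terms -1 weigh
-- nothing and c weighs c + 1, so a zero-sum subsequence of U^[n₁]·V^[n₂] has
-- length (k + 1)a + kb, where a ≤ n₁ and b ≤ n₂ count the heads of U and V it
-- uses. Since k and k + 1 are coprime, t = (m + 1)(k + 1) with b ≤ k forces
-- b = 0 and a = m + 1 > n₁ = m, and t = (m + 1)k with a ≤ k - 1 forces a = 0 and
-- b = m + 1 > n₂ = m. The bound on s'_t(I_k) is then |S| + 1, resp. |R| + 1.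
module Submission where

open import Defs
open import Data.Nat using (ℕ; suc; _+_; _*_; _∸_; _≤_; NonZero)
open import Data.Nat.Divisibility using (_∣_)
open import Data.Nat.DivMod using (_/_)
open import Data.List using (_++_)
open import Data.Product using (_×_)
open import Data.Sum using (_⊎_)
open import Relation.Nullary using (¬_)

open import Data.Nat using (zero; z≤n; s≤s; _<_; _≤?_)
open import Data.Nat.Properties
  using (≤-refl; n≤1+n; +-mono-≤; *-zeroʳ; *-identityʳ; *-distribˡ-+; *-comm;
         +-identityʳ; +-comm; *-cancelˡ-≡; <-irrefl; ≤-pred; ≰⇒>)
open import Data.Nat.Divisibility using (divides; ∣m+n∣m⇒∣n; m∣m*n; ∣1⇒≡1; >⇒∤)
open import Data.Nat.DivMod using (m*n/n≡m)
open import Data.Nat.Coprimality using (Coprime; coprime-divisor)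
import Data.Nat.Coprimality as Coprimality
open import Data.Nat.Solver using (module +-*-Solver)
open import Data.Integer as ℤ using (ℤ; +_)
open import Data.Integer.Properties using (+-identityˡ; +-assoc; +-inverseʳ; +-injective)
import Data.Integer.Solver as ℤ-Solver
open import Data.List using (List; []; _∷_; replicate; length)
open import Data.List.Properties using (length-++; length-replicate)
open import Data.List.Relation.Binary.Sublist.Propositional using (_⊆_; []; _∷_; _∷ʳ_)
open import Data.List.Relation.Unary.All using ([]; _∷_)
open import Data.List.Relation.Unary.All.Properties using (++⁺; replicate⁺)
open import Data.Product using (∃-syntax; _,_; proj₁)
open import Data.Sum using ([_,_])
open import Function using (_∘_)
open import Relation.Nullary using (yes; no; contradiction)
open import Relation.Binary.PropositionalEquality
  using (_≡_; _≢_; refl; sym; trans; cong; cong₂; subst; module ≡-Reasoning)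

σ-++ : ∀ A B → σ (A ++ B) ≡ σ A ℤ.+ σ B
σ-++ []      B = sym (+-identityˡ (σ B))
σ-++ (x ∷ A) B = trans (cong (ℤ._+_ x) (σ-++ A B)) (sym (+-assoc x (σ A) (σ B)))

σ-replicate-1 : ∀ m → σ (replicate m -1ℤ) ≡ ℤ.- (+ m)
σ-replicate-1 zero          = refl
σ-replicate-1 (suc zero)    = refl
σ-replicate-1 (suc (suc m)) = cong (ℤ._+_ -1ℤ) (σ-replicate-1 (suc m))

⊆-++-split : ∀ {a} {X : Set a} {zs : List X} (xs ys : List X) → zs ⊆ xs ++ ys →
             ∃[ xs′ ] ∃[ ys′ ] (xs′ ⊆ xs × ys′ ⊆ ys × zs ≡ xs′ ++ ys′)
⊆-++-split []       ys p = [] , _ , [] , p , refl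
⊆-++-split (x ∷ xs) ys (.x ∷ʳ p) with ⊆-++-split xs ys p
... | xs′ , ys′ , q₁ , q₂ , eq = xs′ , ys′ , x ∷ʳ q₁ , q₂ , eq
⊆-++-split (x ∷ xs) ys (refl ∷ p) with ⊆-++-split xs ys p
... | xs′ , ys′ , q₁ , q₂ , eq = x ∷ xs′ , ys′ , refl ∷ q₁ , q₂ , cong (x ∷_) eq

weight : Seq → ℤ
weight []      = + 0
weight (x ∷ T) = (x ℤ.+ + 1) ℤ.+ weight T

weight≡σ+length : ∀ T → weight T ≡ σ T ℤ.+ + length T
weight≡σ+length []      = refl
weight≡σ+length (x ∷ T) = begin
  (x ℤ.+ + 1) ℤ.+ weight T              ≡⟨ cong (ℤ._+_ (x ℤ.+ + 1)) (weight≡σ+length T) ⟩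
  (x ℤ.+ + 1) ℤ.+ (σ T ℤ.+ + length T)  ≡⟨ rearrange x (σ T) (+ length T) ⟩
  (x ℤ.+ σ T) ℤ.+ (+ 1 ℤ.+ + length T)  ∎
  where
  open ≡-Reasoning
  open ℤ-Solver.+-*-Solver
  rearrange : ∀ x s l → (x ℤ.+ + 1) ℤ.+ (s ℤ.+ l) ≡ (x ℤ.+ s) ℤ.+ (+ 1 ℤ.+ l)
  rearrange = solve 3 (λ x s l → (x :+ con (+ 1)) :+ (s :+ l) := (x :+ s) :+ (con (+ 1) :+ l)) refl

weight-++ : ∀ A B → weight (A ++ B) ≡ weight A ℤ.+ weight B
weight-++ []      B = sym (+-identityˡ (weight B))
weight-++ (x ∷ A) B = trans (cong (ℤ._+_ (x ℤ.+ + 1)) (weight-++ A B))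
                            (sym (+-assoc (x ℤ.+ + 1) (weight A) (weight B)))

weight-zeroSum : ∀ {T} → ZeroSum T → weight T ≡ + length T
weight-zeroSum {T} z = trans (weight≡σ+length T)
                             (trans (cong (λ s → s ℤ.+ + length T) z) (+-identityˡ (+ length T)))

weight-⊆-replicate-1 : ∀ {T} m → T ⊆ replicate m -1ℤ → weight T ≡ + 0
weight-⊆-replicate-1 zero    []         = refl
weight-⊆-replicate-1 (suc m) (_ ∷ʳ p)   = weight-⊆-replicate-1 m p
weight-⊆-replicate-1 (suc m) (refl ∷ p) = trans (+-identityˡ _) (weight-⊆-replicate-1 m p)

Subweights : ℕ → ℕ → Seq → Set
Subweights d n A = ∀ {T} → T ⊆ A → ∃[ a ] (a ≤ n × weight T ≡ + (d * a))

subweights-block : ∀ c m → Subweights (suc c) 1 (+ c ∷ replicate m -1ℤ)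
subweights-block c m (_ ∷ʳ p) =
  0 , z≤n , trans (weight-⊆-replicate-1 m p) (cong +_ (sym (*-zeroʳ c)))
subweights-block c m {_ ∷ T} (refl ∷ p) = 1 , ≤-refl , (begin
  (+ c ℤ.+ + 1) ℤ.+ weight T  ≡⟨ cong (ℤ._+_ (+ c ℤ.+ + 1)) (weight-⊆-replicate-1 m p) ⟩
  + (c + 1 + 0)               ≡⟨ cong +_ (trans (+-identityʳ (c + 1)) (+-comm c 1)) ⟩
  + suc c                     ≡⟨ cong +_ (sym (*-identityʳ (suc c))) ⟩
  + (suc c * 1)               ∎)
  where open ≡-Reasoning

subweights-++ : ∀ {d n₁ n₂ A B} → Subweights d n₁ A → Subweights d n₂ B →
                Subweights d (n₁ + n₂) (A ++ B)
subweights-++ {d} {A = A} {B} swA swB p with ⊆-++-split A B p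
... | T₁ , T₂ , q₁ , q₂ , refl with swA q₁ | swB q₂
... | a₁ , a₁≤n₁ , w₁ | a₂ , a₂≤n₂ , w₂ =
  a₁ + a₂ , +-mono-≤ a₁≤n₁ a₂≤n₂ ,
  trans (weight-++ T₁ T₂) (trans (cong₂ ℤ._+_ w₁ w₂) (cong +_ (sym (*-distribˡ-+ d a₁ a₂))))

subweights-^ : ∀ {d A} → Subweights d 1 A → ∀ n → Subweights d n (A ^[ n ])
subweights-^ {d} sw zero    [] = 0 , z≤n , cong +_ (sym (*-zeroʳ d))
subweights-^ {d} sw (suc n)    = subweights-++ {d} sw (subweights-^ {d} sw n)

zeroSum-⊆-++-length : ∀ {d₁ n₁ d₂ n₂ A B T} → Subweights d₁ n₁ A → Subweights d₂ n₂ B →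
                      T ⊆ A ++ B → ZeroSum T →
                      ∃[ a ] ∃[ b ] (a ≤ n₁ × b ≤ n₂ × d₁ * a + d₂ * b ≡ length T)
zeroSum-⊆-++-length {d₁} {_} {d₂} {A = A} {B} swA swB p z with ⊆-++-split A B p
... | T₁ , T₂ , q₁ , q₂ , refl with swA q₁ | swB q₂
... | a , a≤n₁ , w₁ | b , b≤n₂ , w₂ = a , b , a≤n₁ , b≤n₂ , +-injective (begin
  + (d₁ * a + d₂ * b)          ≡⟨ sym (cong₂ ℤ._+_ w₁ w₂) ⟩
  weight T₁ ℤ.+ weight T₂      ≡⟨ sym (weight-++ T₁ T₂) ⟩
  weight (T₁ ++ T₂)            ≡⟨ weight-zeroSum {T₁ ++ T₂} z ⟩
  + length (T₁ ++ T₂)          ∎)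
  where open ≡-Reasoning

coprime-suc : ∀ k → Coprime (suc k) k
coprime-suc k {d} (d∣1+k , d∣k) = ∣1⇒≡1 (∣m+n∣m⇒∣n (subst (d ∣_) (+-comm 1 k) d∣1+k) d∣k)

-- Reducing modulo p forces y = 0, and then x = n.
coprime-no-representation : ∀ {p q n x y} → Coprime p q → x < n → y < p →
                            p * x + q * y ≢ n * p
coprime-no-representation {p} {q} {n} {x} {zero} _ x<n (s≤s _) eq =
  <-irrefl (*-cancelˡ-≡ x n p (begin
    p * x          ≡⟨ sym (+-identityʳ (p * x)) ⟩
    p * x + 0      ≡⟨ cong (_+_ (p * x)) (sym (*-zeroʳ q)) ⟩
    p * x + q * 0  ≡⟨ eq ⟩
    n * p          ≡⟨ *-comm n p ⟩
    p * n          ∎)) x<n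
  where open ≡-Reasoning
coprime-no-representation {p} {q} {n} {x} {y@(suc _)} p⊥q _ y<p eq =
  >⇒∤ y<p (coprime-divisor p⊥q (∣m+n∣m⇒∣n (divides n eq) (m∣m*n x)))

overI-block : ∀ {k c} m → c ≤ suc k → OverI (suc k) (+ c ∷ replicate m -1ℤ)
overI-block m c≤1+k = (ℤ.-≤+ , ℤ.+≤+ c≤1+k) ∷ replicate⁺ m (ℤ.-≤- z≤n , ℤ.-≤+)

overI-^ : ∀ {k A} n → OverI k A → OverI k (A ^[ n ])
overI-^ zero    over = []
overI-^ (suc n) over = ++⁺ over (overI-^ n over)

zeroSum-block : ∀ c → ZeroSum (+ c ∷ replicate c -1ℤ)
zeroSum-block c = trans (cong (ℤ._+_ (+ c)) (σ-replicate-1 c)) (+-inverseʳ (+ c))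

zeroSum-^ : ∀ {A} n → ZeroSum A → ZeroSum (A ^[ n ])
zeroSum-^         zero    z = refl
zeroSum-^ {A = A} (suc n) z = trans (σ-++ A (A ^[ n ])) (cong₂ ℤ._+_ z (zeroSum-^ n z))

length-^ : ∀ A n → length (A ^[ n ]) ≡ n * length A
length-^ A zero    = refl
length-^ A (suc n) = trans (length-++ A) (cong (_+_ (length A)) (length-^ A n))

UV : ℕ → ℕ → ℕ → Seq
UV k n₁ n₂ = (U k ^[ n₁ ]) ++ (V k ^[ n₂ ])

overI-UV : ∀ k n₁ n₂ → OverI (suc k) (UV (suc k) n₁ n₂)
overI-UV k n₁ n₂ = ++⁺ (overI-^ n₁ (overI-block (suc k) ≤-refl))
                       (overI-^ n₂ (overI-block k (n≤1+n k)))

zeroSum-UV : ∀ k n₁ n₂ → ZeroSum (UV k n₁ n₂)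
zeroSum-UV k n₁ n₂ = trans (σ-++ (U k ^[ n₁ ]) (V k ^[ n₂ ]))
                           (cong₂ ℤ._+_ (zeroSum-^ n₁ (zeroSum-block k))
                                        (zeroSum-^ n₂ (zeroSum-block (k ∸ 1))))

length-UV : ∀ k n₁ n₂ → length (UV k n₁ n₂) ≡ n₁ * suc k + n₂ * suc (k ∸ 1)
length-UV k n₁ n₂ = trans (length-++ (U k ^[ n₁ ]))
  (cong₂ _+_ (trans (length-^ (U k) n₁) (cong (λ l → n₁ * suc l) (length-replicate k)))
             (trans (length-^ (V k) n₂) (cong (λ l → n₂ * suc l) (length-replicate (k ∸ 1)))))

zeroSum-⊆-UV-length : ∀ k n₁ n₂ {T} → T ⊆ UV k n₁ n₂ → ZeroSum T →
                      ∃[ a ] ∃[ b ] (a ≤ n₁ × b ≤ n₂ × suc k * a + suc (k ∸ 1) * b ≡ length T)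
zeroSum-⊆-UV-length k n₁ n₂ =
  zeroSum-⊆-++-length {suc k} {n₁} {suc (k ∸ 1)} {n₂}
                      (subweights-^ {suc k} (subweights-block k k) n₁)
                      (subweights-^ {suc (k ∸ 1)} (subweights-block (k ∸ 1) (k ∸ 1)) n₂)

s'-Witness : ℕ → ℕ → Seq → Set
s'-Witness k t S = OverI k S × ZeroSum S × ¬ HasZeroSumSubseqOfLength t S

s'≥-witness : ∀ {k t S} → s'-Witness k t S → s'≥ k t (suc (length S))
s'≥-witness {S = S} (over , zero-sum , free) ℓ _ s'ℓ with suc (length S) ≤? ℓ
... | yes long = long
... | no  short = contradiction (s'ℓ S over zero-sum (≤-pred (≰⇒> short))) free

witness-a : ∀ k m → s'-Witness (suc k) (suc m * suc (suc k)) (UV (suc k) m (suc k))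
witness-a k m = overI-UV k m (suc k) , zeroSum-UV (suc k) m (suc k) , free
  where
  free : ¬ HasZeroSumSubseqOfLength (suc m * suc (suc k)) (UV (suc k) m (suc k))
  free (T , T⊆S , z , length≡t) with zeroSum-⊆-UV-length (suc k) m (suc k) T⊆S z
  ... | a , b , a≤m , b≤1+k , eq =
    coprime-no-representation (coprime-suc (suc k)) (s≤s a≤m) (s≤s b≤1+k) (trans eq length≡t)

witness-b : ∀ k m → s'-Witness (suc k) (suc m * suc k) (UV (suc k) k m)
witness-b k m = overI-UV k k m , zeroSum-UV (suc k) k m , free
  where
  free : ¬ HasZeroSumSubseqOfLength (suc m * suc k) (UV (suc k) k m)
  free (T , T⊆R , z , length≡t) with zeroSum-⊆-UV-length (suc k) k m T⊆R z
  ... | a , b , a≤k , b≤m , eq =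
    coprime-no-representation (Coprimality.sym (coprime-suc (suc k))) (s≤s b≤m) (s≤s a≤k)
                              (trans (+-comm (suc k * b) _) (trans eq length≡t))

length-witness-a : ∀ k m → suc (length (UV (suc k) m (suc k))) ≡ suc m * suc (suc k) + suc k * k
length-witness-a k m = trans (cong suc (length-UV (suc k) m (suc k))) (identity k m)
  where
  open +-*-Solver
  identity : ∀ k m → suc (m * suc (suc k) + suc k * suc k) ≡ suc m * suc (suc k) + suc k * k
  identity = solve 2 (λ k m → con 1 :+ (m :* (con 2 :+ k) :+ (con 1 :+ k) :* (con 1 :+ k))
                              := (con 1 :+ m) :* (con 2 :+ k) :+ (con 1 :+ k) :* k) refl

length-witness-b : ∀ k m → suc (length (UV (suc k) k m)) ≡ suc m * suc k + suc k * k
length-witness-b k m = trans (cong suc (length-UV (suc k) k m)) (identity k m)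
  where
  open +-*-Solver
  identity : ∀ k m → suc (k * suc (suc k) + m * suc k) ≡ suc m * suc k + suc k * k
  identity = solve 2 (λ k m → con 1 :+ (k :* (con 2 :+ k) :+ m :* (con 1 :+ k))
                              := (con 1 :+ m) :* (con 1 :+ k) :+ (con 1 :+ k) :* k) refl

witness-S : ∀ k t .{{_ : NonZero t}} → suc (suc k) ∣ t →
         let S = UV (suc k) (t / suc (suc k) ∸ 1) (suc k) in
         s'-Witness (suc k) t S × suc (length S) ≡ t + suc k * k
witness-S k .(0 * suc (suc k)) {{()}} (divides zero refl)
witness-S k .(suc m * suc (suc k)) (divides (suc m) refl)
  rewrite m*n/n≡m (suc m) (suc (suc k)) {{_}} = witness-a k m , length-witness-a k m

witness-R : ∀ k t .{{_ : NonZero t}} → suc k ∣ t →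
         let R = UV (suc k) k (t / suc k ∸ 1) in
         s'-Witness (suc k) t R × suc (length R) ≡ t + suc k * k
witness-R k .(0 * suc k) {{()}} (divides zero refl)
witness-R k .(suc m * suc k) (divides (suc m) refl)
  rewrite m*n/n≡m (suc m) (suc k) {{_}} = witness-b k m , length-witness-b k m

lemma3p0 : (k t : ℕ) → .{{_ : NonZero k}} → .{{_ : NonZero t}} →
    ((suc k ∣ t) →
      let S = (U k ^[ (t / suc k) ∸ 1 ]) ++ (V k ^[ k ]) in
      OverI k S × ZeroSum S × ¬ HasZeroSumSubseqOfLength t S)
    × ((k ∣ t) →
      let R = (U k ^[ k ∸ 1 ]) ++ (V k ^[ (t / k) ∸ 1 ]) in
      OverI k R × ZeroSum R × ¬ HasZeroSumSubseqOfLength t R)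
    × ((suc k ∣ t ⊎ k ∣ t) → s'≥ k t (t + k * (k ∸ 1)))
lemma3p0 zero    t {{()}}
lemma3p0 (suc k) t =
  proj₁ ∘ witness-S k t , proj₁ ∘ witness-R k t , [ bound ∘ witness-S k t , bound ∘ witness-R k t ]
  where
  bound : ∀ {S} → s'-Witness (suc k) t S × suc (length S) ≡ t + suc k * k →
          s'≥ (suc k) t (t + suc k * k)
  bound (witness , length≡) = subst (s'≥ (suc k) t) length≡ (s'≥-witness witness)
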